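{- Let $N\ge 1$ and let $\mathcal{G}$ be an $N$-petal flower in which each petal may independently be twisted or untwisted. Then the number of faces (boundary components) $F(\mathcal{G})$ of $\mathcal{G}$ is either $1$ or $2$.
   Context: A ribbon graph is a surface with boundary (not necessarily orientable) presented as a union of closed discs called vertices and edges, such that vertices and edges intersect in disjoint line segments, each such segment lies on the boundary of exactly one vertex and one edge, and every edge contains exactly two such segments. A self-loop is an edge whose two ends are attached to the same vertex $v$; it is twisted if $v\cup e$ is a Möbius band and untwisted if $v\cup e$ is an annulus. The faces of a ribbon graph are the connected components of the boundary of the surface. An $N$-petal flower is a ribbon graph with a single vertex and $N$ self-loops (petals) $e_1,\dots,e_N$, where $e_i$ has ends $a_i,b_i$ attached around the vertex boundary in the cyclic order $a_1,a_2,b_1,a_3,b_2,a_4,b_3,\dots,a_N,b_{N-1},b_N$; thus the ends of $e_i$ and $e_{i+1}$ alternate in the cyclic order for each $i$, while the ends of $e_i$ and $e_j$ do not alternate when $|i-j|\ge 2$. Each petal may be twisted or untwisted. -}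

module Defs where

open import Data.Nat using (ℕ; zero; suc; _+_; _*_; _∸_; _≟_)
open import Data.Fin using (Fin; toℕ)
open import Data.Bool using (Bool; true; false; if_then_else_)
open import Data.Product using (Σ; ∃; _×_; _,_)
open import Data.Sum using (_⊎_)
open import Relation.Nullary.Decidable using (⌊_⌋)
open import Relation.Binary.PropositionalEquality using (_≡_)
open import Relation.Binary.Construct.Closure.ReflexiveTransitive using (Star)
open import Function.Bundles using (_⇔_)

-- Combinatorial model of the boundary of a one-vertex ribbon graph.
-- The vertex boundary circle is traversed in a fixed direction; the 2N
-- attachment segments sit at cyclic positions 0,1,...,2N-1.  Each segment has
-- two endpoints: L (where the traversal enters it) and R (where it leaves).
-- The boundary of the surface is a union of arcs joining these 4N endpoints:
--  * vertex arcs: (p , R) -- (p+1 mod 2N , L);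
--  * edge sides: for a petal with ends at positions p and q,
--      untwisted (annulus):   (p , L) -- (q , R)  and  (p , R) -- (q , L);
--      twisted (Möbius band): (p , L) -- (q , L)  and  (p , R) -- (q , R).
-- Faces = connected components of the resulting graph.

data Side : Set where
  L R : Side

Point : ℕ → Set
Point N = Fin (2 * N) × Side

-- Petals are indexed 0-based by j (petal e_{j+1} of the paper).
-- Cyclic order a1,a2,b1,a3,b2,...,aN,b_{N-1},bN gives
--   a_1 at 0, a_i at 2i-3 (i ≥ 2), b_i at 2i (i ≤ N-1), b_N at 2N-1.
posA : ℕ → ℕ
posA zero    = 0
posA (suc j) = 2 * j + 1

posB : ℕ → ℕ → ℕ
posB N j = if ⌊ suc j ≟ N ⌋ then 2 * N ∸ 1 else 2 * j + 2

data Adj (N : ℕ) (twist : Fin N → Bool) : Point N → Point N → Set where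
  vert-next : ∀ p q → suc (toℕ p) ≡ toℕ q → Adj N twist (p , R) (q , L)
  vert-wrap : ∀ p q → suc (toℕ p) ≡ 2 * N → toℕ q ≡ 0 → Adj N twist (p , R) (q , L)
  untw-LR : ∀ i p q → twist i ≡ false → toℕ p ≡ posA (toℕ i) → toℕ q ≡ posB N (toℕ i)
            → Adj N twist (p , L) (q , R)
  untw-RL : ∀ i p q → twist i ≡ false → toℕ p ≡ posA (toℕ i) → toℕ q ≡ posB N (toℕ i)
            → Adj N twist (p , R) (q , L)
  tw-LL : ∀ i p q → twist i ≡ true → toℕ p ≡ posA (toℕ i) → toℕ q ≡ posB N (toℕ i)
          → Adj N twist (p , L) (q , L)
  tw-RR : ∀ i p q → twist i ≡ true → toℕ p ≡ posA (toℕ i) → toℕ q ≡ posB N (toℕ i)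
          → Adj N twist (p , R) (q , R)

Connected : (N : ℕ) → (Fin N → Bool) → Point N → Point N → Set
Connected N twist = Star (λ x y → Adj N twist x y ⊎ Adj N twist y x)

HasFaces : (N : ℕ) → (Fin N → Bool) → ℕ → Set
HasFaces N twist k =
  Σ (Point N → Fin k) λ c →
    (∀ (f : Fin k) → ∃ λ x → c x ≡ f) ×
    (∀ x y → (c x ≡ c y) ⇔ Connected N twist x y)

-- Cut the boundary of the flower at the 2N attaching segments into 2N vertex arcs ("gaps"); every
-- side of a petal joins two gaps.  Attach the petals one at a time in their cyclic order: each
-- petal joins the gaps of the current frontier only to gaps of the next one, so no boundary
-- component closes up before the last petal, and every strand built so far ends at the arc of
-- W = (0 , L) or of G = (0 , R).  Hence there are at most two faces.  Colour every gap by whether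
-- its strand reaches W: if the last petal respects this colouring, the colouring is invariant
-- along the whole boundary and separates W from G (two faces); otherwise the last petal joins a
-- W-coloured gap to a G-coloured one (one face).
module Submission where

open import Defs
open import Data.Nat using (ℕ; zero; suc; _*_; _∸_; _≤_; _<_; z≤n; s≤s; _≟_; _<?_)
open import Data.Nat.Properties
open import Data.Nat.DivMod using (_mod_; m<n⇒m%n≡m; n%n≡0)
open import Data.Fin using (Fin; zero; suc; toℕ; fromℕ<)
open import Data.Fin.Properties using (toℕ-injective; toℕ-fromℕ<; fromℕ<-toℕ; toℕ<n)
open import Data.Bool using (Bool; true; false)
open import Data.Product using (∃; _×_; _,_; proj₁; proj₂)
open import Data.Sum using (_⊎_; inj₁; inj₂; swap; map₁)
open import Function using (_∘_; id)
open import Relation.Nullary using (yes; no; contradiction)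
open import Relation.Binary.Definitions using (Reflexive; Symmetric)
open import Relation.Binary.PropositionalEquality
open import Relation.Binary.Construct.Closure.ReflexiveTransitive using (ε; _◅_; _◅◅_; reverse; fold)
open import Function.Bundles using (mk⇔)

OneOrTwo : (N : ℕ) → (Fin N → Bool) → Set
OneOrTwo N twist = ∃ λ k → HasFaces N twist k × (k ≡ 1 ⊎ k ≡ 2)

zip-⊎ : ∀ {A B C : Set} → A ⊎ C → B ⊎ C → (A × B) ⊎ C
zip-⊎ (inj₁ a) (inj₁ b) = inj₁ (a , b)
zip-⊎ (inj₂ c) _        = inj₂ c
zip-⊎ _        (inj₂ c) = inj₂ c

module Faces {N : ℕ} (twist : Fin N → Bool) (w g : Point N) where

  infix 4 _~_
  _~_ : Point N → Point N → Set
  _~_ = Connected N twist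

  arc : ∀ {x y} → Adj N twist x y → x ~ y
  arc a = inj₁ a ◅ ε

  ~-sym : ∀ {x y} → x ~ y → y ~ x
  ~-sym = reverse swap

  Invariant : {A : Set} → (Point N → A) → Set
  Invariant f = ∀ {x y} → Adj N twist x y → f x ≡ f y

  invariant-~ : ∀ {A} {f : Point N → A} → Invariant f → ∀ {x y} → x ~ y → f x ≡ f y
  invariant-~ {f = f} inv = fold (λ x y → f x ≡ f y) step refl
    where
      step : ∀ {x y z} → Adj N twist x y ⊎ Adj N twist y x → f y ≡ f z → f x ≡ f z
      step (inj₁ a) p = trans (inv a) p
      step (inj₂ a) p = trans (sym (inv a)) p

  has-faces : ∀ {k} (c : Point N → Fin k) (a : Fin k → Point N) → Invariant c →
              (∀ i → c (a i) ≡ i) → (∀ x → x ~ a (c x)) → HasFaces N twist k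
  has-faces c a inv c∘a anchored =
    c , (λ i → a i , c∘a i) ,
    λ x y → mk⇔ (λ e → subst (λ i → x ~ a i) e (anchored x) ◅◅ ~-sym (anchored y))
                (invariant-~ inv)

  pick : Fin 2 → Point N
  pick zero       = w
  pick (suc zero) = g

  class : Bool → Fin 2
  class true  = zero
  class false = suc zero

  anchor : Bool → Point N
  anchor b = pick (class b)

  bridge : ∀ {x y} b b′ → x ~ anchor b → y ~ anchor b′ → x ~ y → b ≡ b′ ⊎ w ~ g
  bridge true  true  _ _ _ = inj₁ refl
  bridge false false _ _ _ = inj₁ refl
  bridge true  false p q r = inj₂ (~-sym p ◅◅ r ◅◅ q)
  bridge false true  p q r = inj₂ (~-sym q ◅◅ ~-sym r ◅◅ p)

  faces : (f : Point N → Bool) → (∀ x → x ~ anchor (f x)) → f w ≡ true → f g ≡ false →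
          Invariant f ⊎ w ~ g → OneOrTwo N twist
  faces f anchored fw fg (inj₁ inv) =
    2 , has-faces (class ∘ f) pick (cong class ∘ inv)
                  (λ { zero → cong class fw ; (suc zero) → cong class fg }) anchored , inj₂ refl
  faces f anchored _ _ (inj₂ w~g) =
    1 , has-faces (λ _ → zero) (λ _ → w) (λ _ → refl) (λ { zero → refl ; (suc ()) })
                  (λ x → to-w (f x) (anchored x)) , inj₁ refl
    where
      to-w : ∀ b {x} → x ~ anchor b → x ~ w
      to-w true  p = p
      to-w false p = p ◅◅ ~-sym w~g

-- Gap g is the vertex arc entering position g; it meets the points (g - 1 , R) and (g , L), and
-- gaps 0 and 2N are the same arc.  The two sides of a petal with ends a, b join gap a or 1 + a to
-- gap b or 1 + b, as recorded by Linked.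
module Gaps {N′ : ℕ} (twist : Fin (suc N′) → Bool) where

  N : ℕ
  N = suc N′

  W G : Point N
  W = zero , L
  G = zero , R

  open Faces twist W G public

  pt : ℕ → Point N
  pt g = g mod (2 * N) , L

  gap : Point N → ℕ
  gap (p , L) = toℕ p
  gap (p , R) = suc (toℕ p)

  gap≤2N : ∀ x → gap x ≤ 2 * N
  gap≤2N (p , L) = <⇒≤ (toℕ<n p)
  gap≤2N (p , R) = toℕ<n p

  toℕ-mod : ∀ {g} → g < 2 * N → toℕ (g mod (2 * N)) ≡ g
  toℕ-mod h = trans (toℕ-fromℕ< _) (m<n⇒m%n≡m h)

  toℕ-2N-mod : toℕ (2 * N mod (2 * N)) ≡ 0
  toℕ-2N-mod = trans (toℕ-fromℕ< _) (n%n≡0 (2 * N))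

  pt-toℕ : ∀ p → pt (toℕ p) ≡ (p , L)
  pt-toℕ p = cong (_, L) (toℕ-injective (toℕ-mod (toℕ<n p)))

  pt-2N : pt (2 * N) ≡ W
  pt-2N = cong (_, L) (toℕ-injective toℕ-2N-mod)

  R~next : ∀ p → (p , R) ~ pt (suc (toℕ p))
  R~next p with m≤n⇒m<n∨m≡n (toℕ<n p)
  ... | inj₁ h = arc (vert-next p _ (sym (toℕ-mod h)))
  ... | inj₂ e = arc (vert-wrap p _ e (trans (cong (λ m → toℕ (m mod (2 * N))) e) toℕ-2N-mod))

  R~succ : ∀ {a} (h : a < 2 * N) → (a mod (2 * N) , R) ~ pt (suc a)
  R~succ {a} h = subst (λ m → (a mod (2 * N) , R) ~ pt (suc m)) (toℕ-mod h) (R~next _)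

  to-gap : ∀ x → x ~ pt (gap x)
  to-gap (p , L) = subst ((p , L) ~_) (sym (pt-toℕ p)) ε
  to-gap (p , R) = R~next p

  Linked : (ℕ → ℕ → Set) → Bool → ℕ → ℕ → Set
  Linked _∼_ false a b = a ∼ suc b × suc a ∼ b
  Linked _∼_ true  a b = a ∼ b × suc a ∼ suc b

  posA<2N : ∀ {k} → k < N → posA k < 2 * N
  posA<2N {zero}  _ = s≤s z≤n
  posA<2N {suc j} h = subst (_< 2 * N) (+-comm 1 (2 * j))
                            (subst (_≤ 2 * N) (*-suc 2 j) (*-monoʳ-≤ 2 (<⇒≤ h)))

  posB<2N : ∀ {k} → k < N → posB N k < 2 * N
  posB<2N {k} h with suc k ≟ N
  ... | yes _ = n<1+n _
  ... | no ne = subst (_< 2 * N) (+-comm 2 (2 * k))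
                      (subst (_< 2 * N) (*-suc 2 k) (*-monoʳ-< 2 (≤∧≢⇒< h ne)))

  _≈_ : ℕ → ℕ → Set
  u ≈ v = pt u ~ pt v

  petal-linked : ∀ i → Linked _≈_ (twist i) (posA (toℕ i)) (posB N (toℕ i))
  petal-linked i = sides (twist i) refl
    where
      ha : posA (toℕ i) < 2 * N
      ha = posA<2N (toℕ<n i)
      hb : posB N (toℕ i) < 2 * N
      hb = posB<2N (toℕ<n i)

      sides : ∀ b → twist i ≡ b → Linked _≈_ b (posA (toℕ i)) (posB N (toℕ i))
      sides false t = arc (untw-LR i _ _ t (toℕ-mod ha) (toℕ-mod hb)) ◅◅ R~succ hb ,
                      ~-sym (R~succ ha) ◅◅ arc (untw-RL i _ _ t (toℕ-mod ha) (toℕ-mod hb))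
      sides true  t = arc (tw-LL i _ _ t (toℕ-mod ha) (toℕ-mod hb)) ,
                      ~-sym (R~succ ha) ◅◅ arc (tw-RR i _ _ t (toℕ-mod ha) (toℕ-mod hb)) ◅◅ R~succ hb

  Agree : (ℕ → Bool) → ℕ → ℕ → Set
  Agree c u v = c u ≡ c v

  Respects : (ℕ → Bool) → Set
  Respects c = c (2 * N) ≡ c 0 ×
               (∀ i → Linked (Agree c) (twist i) (posA (toℕ i)) (posB N (toℕ i)))

  respects⇒invariant : ∀ {c} → Respects c → Invariant (c ∘ gap)
  respects⇒invariant {c} (wrap , petals) = invariant
    where
      via : ∀ {u u′ v v′} → u ≡ u′ → c u′ ≡ c v′ → v ≡ v′ → c u ≡ c v
      via refl p refl = p

      linked : ∀ {b} i → twist i ≡ b → Linked (Agree c) b (posA (toℕ i)) (posB N (toℕ i))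
      linked i t = subst (λ b → Linked _ b _ _) t (petals i)

      invariant : Invariant (c ∘ gap)
      invariant (vert-next p q e)         = cong c e
      invariant (vert-wrap p q e e′)      = via e wrap e′
      invariant (untw-LR i p q t ea eb)   = via ea (proj₁ (linked i t)) (cong suc eb)
      invariant (untw-RL i p q t ea eb)   = via (cong suc ea) (proj₂ (linked i t)) eb
      invariant (tw-LL i p q t ea eb)     = via ea (proj₁ (linked i t)) eb
      invariant (tw-RR i p q t ea eb)     = via (cong suc ea) (proj₂ (linked i t)) (cong suc eb)

  faces-by-colour : (c : ℕ → Bool) → (∀ g → g ≤ 2 * N → pt g ~ anchor (c g)) →
                    c 0 ≡ true → c 1 ≡ false → Respects c ⊎ W ~ G → OneOrTwo N twist
  faces-by-colour c anchored c0 c1 r =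
    faces (c ∘ gap) (λ x → to-gap x ◅◅ anchored (gap x) (gap≤2N x)) c0 c1
          (map₁ respects⇒invariant r)

single-petal : (twist : Fin 1 → Bool) → OneOrTwo 1 twist
single-petal twist = faces-by-colour colour anchored refl refl (decide (twist zero) refl)
  where
    open Gaps twist

    colour : ℕ → Bool
    colour 1 = false
    colour _ = true

    anchored : ∀ g → g ≤ 2 → pt g ~ anchor (colour g)
    anchored 0 _ = ε
    anchored 1 _ = ~-sym (R~next zero)
    anchored 2 _ = subst (_~ W) (sym pt-2N) ε
    anchored (suc (suc (suc _))) (s≤s (s≤s ()))

    decide : ∀ b → twist zero ≡ b → Respects colour ⊎ W ~ G
    decide false t = inj₁ (refl , λ { zero → subst (λ b → Linked (Agree colour) b 0 1)
                                                   (sym t) (refl , refl) })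
    decide true  t = inj₂ (proj₁ (subst (λ b → Linked _≈_ b 0 1) t (petal-linked zero))
                           ◅◅ ~-sym (R~next zero))

data Slot : Set where
  X Y Z : Slot

dbl : ℕ → ℕ
dbl zero    = zero
dbl (suc j) = suc (suc (dbl j))

dbl≡2* : ∀ j → dbl j ≡ 2 * j
dbl≡2* zero    = refl
dbl≡2* (suc j) = trans (cong (λ m → suc (suc m)) (dbl≡2* j)) (sym (*-suc 2 j))

dbl-mono-≤ : ∀ {a b} → a ≤ b → dbl a ≤ dbl b
dbl-mono-≤ z≤n     = z≤n
dbl-mono-≤ (s≤s h) = s≤s (s≤s (dbl-mono-≤ h))

dbl≤1+dbl⇒≤ : ∀ {a b} → dbl a ≤ suc (dbl b) → a ≤ b
dbl≤1+dbl⇒≤ {zero}              _               = z≤n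
dbl≤1+dbl⇒≤ {suc _} {zero}      (s≤s ())
dbl≤1+dbl⇒≤ {suc _} {suc _}     (s≤s (s≤s h))   = s≤s (dbl≤1+dbl⇒≤ h)

data Parity : ℕ → Set where
  even : ∀ s → Parity (dbl s)
  odd  : ∀ s → Parity (suc (dbl s))

parity : ∀ g → Parity g
parity zero = even zero
parity (suc g) with parity g
... | even s = odd s
... | odd s  = even (suc s)

module Flower {n : ℕ} (twist : Fin (suc (suc n)) → Bool) where

  open Gaps twist

  tw : ℕ → Bool
  tw k with k <? N
  ... | yes h = twist (fromℕ< h)
  ... | no _  = false

  tw-toℕ : ∀ i → twist i ≡ tw (toℕ i)
  tw-toℕ i with toℕ i <? N
  ... | yes h = cong twist (sym (fromℕ<-toℕ i h))
  ... | no ¬h = contradiction (toℕ<n i) ¬h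

  Petal : (ℕ → ℕ → Set) → ℕ → Set
  Petal Q k = Linked Q (tw k) (posA k) (posB N k)

  petal : ∀ k → k < N → Petal _≈_ k
  petal k h = subst (Petal _≈_) (toℕ-fromℕ< h)
                (subst (λ b → Linked _≈_ b _ _) (tw-toℕ (fromℕ< h)) (petal-linked (fromℕ< h)))

  -- Stage s (before petal s) has a frontier of three
  -- gaps slot s X < slot s Y < slot s Z through which the strands built so far leave, and petal s
  -- joins slot s X and slot s Y to slot (1 + s) Y and slot (1 + s) Z, while slot s Z = slot (1 + s) X.
  -- Stage 0 is fictitious: its frontier is W's gap 0 and G's gap 1 (twice).
  slotX : ℕ → ℕ
  slotX zero    = zero
  slotX (suc s) = suc (dbl s)

  slot : ℕ → Slot → ℕ
  slot s X = slotX s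
  slot s Y = suc (slotX s)
  slot s Z = slotX (suc s)

  previous : Bool → Slot → Slot
  previous _     X = Z
  previous false Y = Y
  previous true  Y = X
  previous false Z = X
  previous true  Z = Y

  strand : ℕ → Slot → Bool
  strand zero    X = true
  strand zero    Y = false
  strand zero    Z = false
  strand (suc s) e = strand s (previous (tw s) e)

  posA-slot : ∀ k → posA k ≡ slot k X
  posA-slot zero    = refl
  posA-slot (suc j) = trans (+-comm (2 * j) 1) (cong suc (sym (dbl≡2* j)))

  posB-inner : ∀ {k} → k ≤ n → posB N k ≡ slot (suc k) Y
  posB-inner {k} h with suc k ≟ N
  ... | yes e = contradiction (s≤s h) (<-irrefl (suc-injective e))
  ... | no _  = trans (+-comm (2 * k) 2) (cong (λ m → suc (suc m)) (sym (dbl≡2* k)))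

  posB-last : posB N (suc n) ≡ slot (suc n) Z
  posB-last with suc (suc n) ≟ N
  ... | yes _ = cong (_∸ 1) (sym (dbl≡2* N))
  ... | no ne = contradiction refl ne

  inner-petal : ∀ {Q k} → k ≤ n → Petal Q k ≡ Linked Q (tw k) (slot k X) (slot (suc k) Y)
  inner-petal {Q} {k} h = cong₂ (Linked Q (tw k)) (posA-slot k) (posB-inner h)

  last-petal : ∀ {Q} → Petal Q (suc n) ≡ Linked Q (tw (suc n)) (slot (suc n) X) (slot (suc n) Z)
  last-petal {Q} = cong₂ (Linked Q (tw (suc n))) (posA-slot (suc n)) posB-last

  linked⇒joined : ∀ {Q} → Reflexive Q → Symmetric Q → ∀ {s} b →
                  Linked Q b (slot s X) (slot (suc s) Y) →
                  ∀ e → Q (slot (suc s) e) (slot s (previous b e))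
  linked⇒joined r _  _     _       X = r
  linked⇒joined _ sy false (l , m) Y = sy m
  linked⇒joined _ sy false (l , m) Z = sy l
  linked⇒joined _ sy true  (l , m) Y = sy l
  linked⇒joined _ sy true  (l , m) Z = sy m

  joined⇒linked : ∀ {Q} → Symmetric Q → ∀ {s} b →
                  (∀ e → Q (slot (suc s) e) (slot s (previous b e))) →
                  Linked Q b (slot s X) (slot (suc s) Y)
  joined⇒linked sy false j = sy (j Z) , sy (j Y)
  joined⇒linked sy true  j = sy (j Y) , sy (j Z)

  anchored : ∀ s → s ≤ suc n → ∀ e → pt (slot s e) ~ anchor (strand s e)
  anchored zero    _ X = ε
  anchored zero    _ Y = ~-sym (R~next zero)
  anchored zero    _ Z = ~-sym (R~next zero)
  anchored (suc s) h e =
    linked⇒joined ε ~-sym (tw s) (subst id (inner-petal (≤-pred h)) (petal s (m≤n⇒m≤1+n h))) e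
    ◅◅ anchored s (<⇒≤ h) (previous (tw s) e)

  -- The value of σ at gap 1 + g.
  strand-at : (ℕ → Slot → Bool) → ℕ → Bool
  strand-at σ zero          = σ 0 Z
  strand-at σ (suc zero)    = σ 1 Y
  strand-at σ (suc (suc g)) = strand-at (σ ∘ suc) g

  strand-at-Z : ∀ σ s → strand-at σ (dbl s) ≡ σ s Z
  strand-at-Z σ zero    = refl
  strand-at-Z σ (suc s) = strand-at-Z (σ ∘ suc) s

  strand-at-Y : ∀ σ s → strand-at σ (suc (dbl s)) ≡ σ (suc s) Y
  strand-at-Y σ zero    = refl
  strand-at-Y σ (suc s) = strand-at-Y (σ ∘ suc) s

  -- Gap 2N is W's arc again, hence its special case.
  colour : ℕ → Bool
  colour zero = true
  colour (suc g) with suc g ≟ 2 * N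
  ... | yes _ = true
  ... | no _  = strand-at strand g

  colour-2N : ∀ g → g ≡ 2 * N → colour g ≡ true
  colour-2N (suc g) e with suc g ≟ 2 * N
  ... | yes _ = refl
  ... | no ne = contradiction e ne

  colour-below : ∀ g → suc g < 2 * N → colour (suc g) ≡ strand-at strand g
  colour-below g h with suc g ≟ 2 * N
  ... | yes e = contradiction h (<-irrefl e)
  ... | no _  = refl

  slot≤slotZ : ∀ s e → slot s e ≤ slot s Z
  slot≤slotZ zero    X = z≤n
  slot≤slotZ zero    Y = ≤-refl
  slot≤slotZ (suc s) X = m≤n+m _ 2
  slot≤slotZ (suc s) Y = n≤1+n _
  slot≤slotZ s       Z = ≤-refl

  slot<2N : ∀ {s} e → s ≤ suc n → slot s e < 2 * N
  slot<2N {s} e h =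
    subst (slot s e <_) (dbl≡2* N) (s≤s (≤-trans (slot≤slotZ s e) (s≤s (dbl-mono-≤ h))))

  colour-slot : ∀ s e → s ≤ suc n → colour (slot s e) ≡ strand s e
  colour-slot zero    X _ = refl
  colour-slot zero    Y h = colour-below 0 (slot<2N Y h)
  colour-slot (suc s) X h = trans (colour-below _ (slot<2N X h)) (strand-at-Z strand s)
  colour-slot (suc s) Y h = trans (colour-below _ (slot<2N Y h)) (strand-at-Y strand s)
  colour-slot s       Z h = trans (colour-below _ (slot<2N Z h)) (strand-at-Z strand s)

  colour-anchored-slot : ∀ s → s ≤ suc n → ∀ e → pt (slot s e) ~ anchor (colour (slot s e))
  colour-anchored-slot s h e =
    subst (λ b → pt (slot s e) ~ anchor b) (sym (colour-slot s e h)) (anchored s h e)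

  colour-anchored-2N : pt (dbl N) ~ anchor (colour (dbl N))
  colour-anchored-2N =
    subst (λ g → pt g ~ anchor (colour g)) (sym (dbl≡2* N))
          (subst (λ b → pt (2 * N) ~ anchor b) (sym (colour-2N _ refl)) (subst (_~ W) (sym pt-2N) ε))

  colour-anchored : ∀ g → g ≤ 2 * N → pt g ~ anchor (colour g)
  colour-anchored g h with parity g | subst (g ≤_) (sym (dbl≡2* N)) h
  ... | even zero    | _                   = ε
  ... | even (suc s) | s≤s (s≤s h′) with m≤n⇒m<n∨m≡n (dbl≤1+dbl⇒≤ (m≤n⇒m≤1+n h′))
  ...   | inj₁ s<1+n = colour-anchored-slot (suc s) s<1+n Y
  ...   | inj₂ refl  = colour-anchored-2N
  colour-anchored g h | odd s | s≤s h′ = colour-anchored-slot s (dbl≤1+dbl⇒≤ h′) Z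

  inner-petal-coloured : ∀ {k} → k ≤ n → Petal (Agree colour) k
  inner-petal-coloured {k} h = subst id (sym (inner-petal h)) (joined⇒linked sym (tw k) λ e →
    trans (colour-slot (suc k) e (s≤s h)) (sym (colour-slot k (previous (tw k) e) (m≤n⇒m≤1+n h))))

  colour-anchored-last : ∀ e → pt (slot (suc n) e) ~ anchor (colour (slot (suc n) e))
  colour-anchored-last = colour-anchored-slot (suc n) ≤-refl

  last-petal-coloured : ∀ b → Linked _≈_ b (slot (suc n) X) (slot (suc n) Z) →
                        Linked (Agree colour) b (slot (suc n) X) (slot (suc n) Z) ⊎ W ~ G
  last-petal-coloured false (l , m) =
    zip-⊎ (bridge _ _ (colour-anchored-last X) colour-anchored-2N l)
          (bridge _ _ (colour-anchored-last Y) (colour-anchored-last Z) m)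
  last-petal-coloured true  (l , m) =
    zip-⊎ (bridge _ _ (colour-anchored-last X) (colour-anchored-last Z) l)
          (bridge _ _ (colour-anchored-last Y) colour-anchored-2N m)

  petal-coloured : Petal (Agree colour) (suc n) → ∀ k → k < N → Petal (Agree colour) k
  petal-coloured last k h with m≤n⇒m<n∨m≡n (≤-pred h)
  ... | inj₁ k<1+n = inner-petal-coloured (≤-pred k<1+n)
  ... | inj₂ refl  = last

  respects-or-joined : Respects colour ⊎ W ~ G
  respects-or-joined
    with last-petal-coloured (tw (suc n)) (subst id last-petal (petal (suc n) ≤-refl))
  ... | inj₂ w~g = inj₂ w~g
  ... | inj₁ ok  = inj₁ (colour-2N _ refl , λ i →
          subst (λ b → Linked (Agree colour) b _ _) (sym (tw-toℕ i))
                (petal-coloured (subst id (sym last-petal) ok) (toℕ i) (toℕ<n i)))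

  flower-faces : OneOrTwo N twist
  flower-faces = faces-by-colour colour colour-anchored refl (colour-slot 0 Y z≤n) respects-or-joined

theorem1 : (N : ℕ) → 1 ≤ N → (twist : Fin N → Bool) →
    ∃ λ k → HasFaces N twist k × (k ≡ 1 ⊎ k ≡ 2)
theorem1 zero          ()
theorem1 (suc zero)    _ twist = single-petal twist
theorem1 (suc (suc n)) _ twist = Flower.flower-faces twist
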